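{- For any binary matrix $A$, the base graph $G_A$ of $A$ is acyclic, both with respect to the binary setting and with respect to the boolean setting.
   Context: A binary matrix has entries in $\{0,1\}$. A set $X$ of binary vectors spans a set $Y$ in the binary (resp. boolean) setting if every vector of $Y$ is a linear combination of vectors of $X$ with coefficients in $\{0,1\}$ using ordinary (resp. boolean, $1+1=1$) addition. A base of an $n\times m$ binary matrix $A$ is a set of vectors in $\{0,1\}^n$ spanning all columns of $A$, of minimum cardinality among all such spanning sets. The base graph $G_A$ (in a given setting) is the directed graph whose vertices are the bases of $A$, with a directed edge from $U$ to $V$ ($U\neq V$) whenever $U$ spans $V$. -}

module Defs where

open import Data.Bool using (Bool; true; false; _∨_; if_then_else_)
open import Data.Nat using (ℕ; zero; suc; _+_; _≤_)
open import Data.Fin using (Fin; zero; suc)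
open import Data.Vec using (Vec; replicate; zipWith; map)
open import Data.List using (List; []; _∷_; length)
open import Data.List.Membership.Propositional using (_∈_)
open import Data.List.Relation.Unary.Unique.Propositional using (Unique)
open import Data.Product using (Σ; _×_)
open import Relation.Nullary using (¬_)
open import Relation.Binary.PropositionalEquality using (_≡_)
open import Relation.Binary.Construct.Closure.Transitive using (TransClosure)

BVec : ℕ → Set
BVec n = Vec Bool n

-- an n × m binary matrix, given by its m columns
BMatrix : ℕ → ℕ → Set
BMatrix n m = Fin m → BVec n

-- a finite set of binary vectors: a duplicate-free list (cardinality = length)
VSet : ℕ → Set
VSet n = List (BVec n)

data Setting : Set where
  binary boolean : Setting

-- the arithmetic in which linear combinations are evaluated
Scalar : Setting → Set
Scalar binary  = ℕ      -- ordinary addition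
Scalar boolean = Bool   -- boolean addition, 1 + 1 = 1

zeroS : (s : Setting) → Scalar s
zeroS binary  = 0
zeroS boolean = false

addS : (s : Setting) → Scalar s → Scalar s → Scalar s
addS binary  = _+_
addS boolean = _∨_

embS : (s : Setting) → Bool → Scalar s
embS binary  b = if b then 1 else 0
embS boolean b = b

embV : ∀ {n} (s : Setting) → BVec n → Vec (Scalar s) n
embV s v = map (embS s) v

comb : ∀ {n} (s : Setting) (X : VSet n) → (Fin (length X) → Bool) → Vec (Scalar s) n
comb s []      c = replicate _ (zeroS s)
comb s (x ∷ X) c =
  zipWith (addS s) (if c zero then embV s x else replicate _ (zeroS s))
                   (comb s X (λ i → c (suc i)))

SpansVec : ∀ {n} → Setting → VSet n → BVec n → Set
SpansVec s X y = Σ (Fin (length X) → Bool) (λ c → comb s X c ≡ embV s y)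

Spans : ∀ {n} → Setting → VSet n → VSet n → Set
Spans s X Y = ∀ y → y ∈ Y → SpansVec s X y

SpansCols : ∀ {n m} → Setting → BMatrix n m → VSet n → Set
SpansCols s A X = ∀ j → SpansVec s X (A j)

IsBase : ∀ {n m} → Setting → BMatrix n m → VSet n → Set
IsBase s A X =
  Unique X × SpansCols s A X ×
  (∀ Y → Unique Y → SpansCols s A Y → length X ≤ length Y)

_≈ₛ_ : ∀ {n} → VSet n → VSet n → Set
X ≈ₛ Y = ∀ v → (v ∈ X → v ∈ Y) × (v ∈ Y → v ∈ X)

Edge : ∀ {n m} → Setting → BMatrix n m → VSet n → VSet n → Set
Edge s A U V = IsBase s A U × IsBase s A V × ¬ (U ≈ₛ V) × Spans s U V

Acyclic : ∀ {n m} → Setting → BMatrix n m → Set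
Acyclic s A = ∀ U V → TransClosure (Edge s A) U V → ¬ (U ≈ₛ V)

-- A base U is irredundant: no u ∈ U is spanned by the other vectors of U, or removing it would
-- leave a smaller spanning set. Suppose an irredundant U and some V span each other. Writing
-- u ∈ U as a combination of V and substituting for each vector of V its combination over U
-- gives a combination of u over U whose coefficients can be truncated to {0,1}: in the boolean
-- setting by idempotence, in the binary one because the result is a 0/1 vector, so no
-- vector of U is counted twice on a coordinate where it is nonzero. As all entries are
-- nonnegative, every vector used in a combination lies componentwise below the result. If the
-- coefficient of u itself vanishes, u is redundant; otherwise u ≤ v ≤ u for some v ∈ V, so
-- u ∈ V. Hence bases spanning each other coincide, while along a cycle U → W → ⋯ → U the
-- bases U ≠ W span each other.
module Submission where

open import Defs
import Algebra.Properties.Semiring.Sum as ∑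
open import Data.Bool using (Bool; true; false; _∧_; if_then_else_; b≤b; f≤t)
  renaming (_≤_ to _≤ᴮ_)
open import Data.Bool.Properties using (∧-conicalˡ; ∧-conicalʳ)
  renaming (_≟_ to _≟ᴮ_; ≤-antisym to ≤ᴮ-antisym)
open import Data.Empty using (⊥-elim)
open import Data.Fin using (Fin; zero; suc)
open import Data.List using (List; []; _∷_; length; removeAt)
import Data.List as List
open import Data.List.Membership.Propositional using (_∈_)
open import Data.List.Membership.Propositional.Properties using (∈-lookup)
open import Data.List.Properties using (length-removeAt′)
open import Data.List.Relation.Unary.All using (All; _∷_)
open import Data.List.Relation.Unary.AllPairs using (_∷_)
open import Data.List.Relation.Unary.Any using (here; there; index)
open import Data.List.Relation.Unary.Any.Properties using (lookup-index)
open import Data.List.Relation.Unary.Unique.Propositional using (Unique)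
open import Data.Nat using (ℕ; zero; suc; _+_; _*_; _≤_; z≤n; s≤s)
open import Data.Nat.Properties
  using (+-*-semiring; +-identityʳ; *-zeroʳ; *-assoc; m≤m+n; ≤-trans; n≮n)
open import Data.Product using (∃-syntax; _×_; _,_; proj₁)
open import Data.Vec using (lookup; replicate)
open import Data.Vec.Properties using (lookup-map; lookup-zipWith; lookup-replicate; ≡-dec)
open import Data.Vec.Relation.Binary.Pointwise.Extensional using (ext; Pointwise-≡⇒≡)
open import Function using (_∘_)
open import Relation.Nullary using (¬_; yes; no)
open import Relation.Binary.PropositionalEquality
  using (_≡_; _≢_; refl; sym; trans; cong; cong₂; subst; module ≡-Reasoning)
open import Relation.Binary.Construct.Closure.Transitive using (TransClosure; [_]; _∷_)

open ∑ +-*-semiring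
  using (sum; sum-syntax; sum-cong-≗; sum-remove; sum-replicate-zero; ∑-comm; *-distribˡ-sum; *-distribʳ-sum)

private
  variable
    n : ℕ
    s : Setting
    X Y Z U V : VSet n
    x y z u : BVec n

bit : Bool → ℕ
bit false = 0
bit true  = 1

positive : ℕ → Bool
positive zero    = false
positive (suc _) = true

truncate : ℕ → ℕ
truncate m = bit (positive m)

-- Combinations are evaluated in ℕ and then read in the setting: the binary setting keeps
-- the number, the boolean one only whether it is positive.
fromℕ : (s : Setting) → ℕ → Scalar s
fromℕ binary  m = m
fromℕ boolean m = positive m

infix 4 _≈⟨_⟩_
_≈⟨_⟩_ : ℕ → Setting → ℕ → Set
m ≈⟨ s ⟩ m′ = fromℕ s m ≡ fromℕ s m′

bit≤1 : ∀ b → bit b ≤ 1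
bit≤1 false = z≤n
bit≤1 true  = s≤s z≤n

bit-∧ : ∀ a b → bit (a ∧ b) ≡ bit a * bit b
bit-∧ false b     = refl
bit-∧ true  false = refl
bit-∧ true  true  = refl

positive-bit : ∀ b → positive (bit b) ≡ b
positive-bit false = refl
positive-bit true  = refl

positive-truncate : ∀ m → positive (truncate m) ≡ positive m
positive-truncate zero    = refl
positive-truncate (suc _) = refl

truncate-≤1 : ∀ {m} → m ≤ 1 → truncate m ≡ m
truncate-≤1 z≤n       = refl
truncate-≤1 (s≤s z≤n) = refl

bit-positive-∧ : ∀ m b → bit (positive m ∧ b) ≡ truncate (m * bit b)
bit-positive-∧ zero    b     = refl
bit-positive-∧ (suc m) true  = refl
bit-positive-∧ (suc m) false = cong truncate (sym (*-zeroʳ m))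

fromℕ-0 : ∀ s → zeroS s ≡ fromℕ s 0
fromℕ-0 binary  = refl
fromℕ-0 boolean = refl

fromℕ-+ : ∀ s m m′ → addS s (fromℕ s m) (fromℕ s m′) ≡ fromℕ s (m + m′)
fromℕ-+ binary  m       m′ = refl
fromℕ-+ boolean zero    m′ = refl
fromℕ-+ boolean (suc m) m′ = refl

embS-bit : ∀ s b → embS s b ≡ fromℕ s (bit b)
embS-bit binary  false = refl
embS-bit binary  true  = refl
embS-bit boolean false = refl
embS-bit boolean true  = refl

bit-*-cong : ∀ s b {m m′} → m ≈⟨ s ⟩ m′ → bit b * m ≈⟨ s ⟩ bit b * m′
bit-*-cong s false eq = refl
bit-*-cong s true {m} {m′} eq rewrite +-identityʳ m | +-identityʳ m′ = eq

∑-cong-≈ : ∀ s {k} {f g : Fin k → ℕ} → (∀ j → f j ≈⟨ s ⟩ g j) → sum f ≈⟨ s ⟩ sum g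
∑-cong-≈ s {zero}  eq = refl
∑-cong-≈ s {suc k} eq =
  trans (sym (fromℕ-+ s _ _)) (trans (cong₂ (addS s) (eq zero) (∑-cong-≈ s (eq ∘ suc))) (fromℕ-+ s _ _))

term≤∑ : ∀ {k} (f : Fin k → ℕ) j → f j ≤ sum f
term≤∑ {suc k} f j = subst (f j ≤_) (sym (sum-remove {i = j} f)) (m≤m+n _ _)

∑-positive : ∀ {k} (f : Fin k → ℕ) → positive (sum f) ≡ true → ∃[ j ] positive (f j) ≡ true
∑-positive {suc k} f pos with f zero in eq
... | suc _ = zero , cong positive eq
... | zero with ∑-positive (f ∘ suc) pos
...   | j , posⱼ = suc j , posⱼ

∑-truncate : ∀ s {k} (f : Fin k → ℕ) b → sum f ≈⟨ s ⟩ bit b → sum (truncate ∘ f) ≈⟨ s ⟩ sum f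
∑-truncate binary  f b eq =
  sum-cong-≗ (λ j → truncate-≤1 (≤-trans (term≤∑ f j) (subst (_≤ 1) (sym eq) (bit≤1 b))))
∑-truncate boolean f b eq = ∑-cong-≈ boolean (positive-truncate ∘ f)

count : (X : VSet n) → (Fin (length X) → Bool) → Fin n → ℕ
count X c i = ∑[ j < length X ] bit (c j ∧ lookup (List.lookup X j) i)

lookup-embV : ∀ s (y : BVec n) i → lookup (embV s y) i ≡ fromℕ s (bit (lookup y i))
lookup-embV s y i = trans (lookup-map i (embS s) y) (embS-bit s (lookup y i))

lookup-summand : ∀ s b (x : BVec n) i →
                 lookup (if b then embV s x else replicate n (zeroS s)) i ≡ fromℕ s (bit (b ∧ lookup x i))
lookup-summand s true  x i = lookup-embV s x i
lookup-summand s false x i = trans (lookup-replicate i (zeroS s)) (fromℕ-0 s)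

lookup-comb : ∀ s (X : VSet n) c i → lookup (comb s X c) i ≡ fromℕ s (count X c i)
lookup-comb s []      c i = trans (lookup-replicate i (zeroS s)) (fromℕ-0 s)
lookup-comb s (x ∷ X) c i = begin
  lookup (comb s (x ∷ X) c) i
    ≡⟨ lookup-zipWith (addS s) i (if c zero then embV s x else replicate _ (zeroS s)) (comb s X (c ∘ suc)) ⟩
  addS s (lookup (if c zero then embV s x else replicate _ (zeroS s)) i) (lookup (comb s X (c ∘ suc)) i)
    ≡⟨ cong₂ (addS s) (lookup-summand s (c zero) x i) (lookup-comb s X (c ∘ suc) i) ⟩
  addS s (fromℕ s (bit (c zero ∧ lookup x i))) (fromℕ s (count X (c ∘ suc) i))
    ≡⟨ fromℕ-+ s _ _ ⟩
  fromℕ s (count (x ∷ X) c i) ∎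
  where open ≡-Reasoning

record Represents (s : Setting) (X : VSet n) (c : Fin (length X) → Bool) (y : BVec n) : Set where
  constructor represents
  field count≈ : ∀ i → count X c i ≈⟨ s ⟩ bit (lookup y i)
open Represents

SpansVec⇒Represents : (sp : SpansVec s X y) → Represents s X (proj₁ sp) y
SpansVec⇒Represents {s = s} {X = X} {y = y} (c , eq) = represents λ i →
  trans (sym (lookup-comb s X c i)) (trans (cong (λ v → lookup v i) eq) (lookup-embV s y i))

Represents⇒SpansVec : ∀ {c} → Represents s X c y → SpansVec s X y
Represents⇒SpansVec {s = s} {X = X} {y = y} {c} r =
  c , Pointwise-≡⇒≡ (ext λ i → trans (lookup-comb s X c i) (trans (count≈ r i) (sym (lookup-embV s y i))))

_⊑_ : BVec n → BVec n → Set
x ⊑ y = ∀ i → lookup x i ≤ᴮ lookup y i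

⊑-antisym : x ⊑ y → y ⊑ x → x ≡ y
⊑-antisym x⊑y y⊑x = Pointwise-≡⇒≡ (ext λ i → ≤ᴮ-antisym (x⊑y i) (y⊑x i))

bit≤-≈⇒≤ᴮ : ∀ s a b {m} → bit a ≤ m → m ≈⟨ s ⟩ bit b → a ≤ᴮ b
bit≤-≈⇒≤ᴮ s       false false _ _ = b≤b
bit≤-≈⇒≤ᴮ s       false true  _ _ = f≤t
bit≤-≈⇒≤ᴮ s       true  true  _ _ = b≤b
bit≤-≈⇒≤ᴮ binary  true  false (s≤s _) ()
bit≤-≈⇒≤ᴮ boolean true  false {suc _} _ ()

Represents⇒⊑ : ∀ {c j} → Represents s X c y → c j ≡ true → List.lookup X j ⊑ y
Represents⇒⊑ {s = s} {X = X} {y = y} {c} {j} r cⱼ i =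
  bit≤-≈⇒≤ᴮ s _ (lookup y i)
    (subst (λ b → bit (b ∧ lookup (List.lookup X j) i) ≤ count X c i) cⱼ (term≤∑ _ j))
    (count≈ r i)

-- If S j expresses Y j over X and T expresses z over Y, then compose S T expresses z over X.
compose : ∀ {k l} → (Fin l → Fin k → Bool) → (Fin l → Bool) → Fin k → Bool
compose {l = l} S T q = positive (∑[ j < l ] bit (T j ∧ S j q))

compose-witness : ∀ {k l} {S : Fin l → Fin k → Bool} {T q} →
                  compose S T q ≡ true → ∃[ j ] T j ≡ true × S j q ≡ true
compose-witness {T = T} {q} eq with ∑-positive _ eq
... | j , pos = j , ∧-conicalˡ (T j) _ both , ∧-conicalʳ (T j) _ both
  where both = trans (sym (positive-bit _)) pos

∑-bit-compose : ∀ {k l} (S : Fin l → Fin k → Bool) (T : Fin l → Bool) (x : Fin k → Bool) →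
                ∑[ q < k ] ((∑[ j < l ] bit (T j ∧ S j q)) * bit (x q))
                  ≡ ∑[ j < l ] (bit (T j) * ∑[ q < k ] bit (S j q ∧ x q))
∑-bit-compose {k} {l} S T x = begin
  ∑[ q < k ] ((∑[ j < l ] bit (T j ∧ S j q)) * bit (x q))
    ≡⟨ sum-cong-≗ (λ q → *-distribʳ-sum (bit (x q)) (λ j → bit (T j ∧ S j q))) ⟩
  ∑[ q < k ] ∑[ j < l ] (bit (T j ∧ S j q) * bit (x q))
    ≡⟨ ∑-comm (λ q j → bit (T j ∧ S j q) * bit (x q)) ⟩
  ∑[ j < l ] ∑[ q < k ] (bit (T j ∧ S j q) * bit (x q))
    ≡⟨ sum-cong-≗ (λ j → sum-cong-≗ (λ q → reassociate (T j) (S j q) (x q))) ⟩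
  ∑[ j < l ] ∑[ q < k ] (bit (T j) * bit (S j q ∧ x q))
    ≡⟨ sum-cong-≗ (λ j → sym (*-distribˡ-sum (bit (T j)) (λ q → bit (S j q ∧ x q)))) ⟩
  ∑[ j < l ] (bit (T j) * ∑[ q < k ] bit (S j q ∧ x q)) ∎
  where
  open ≡-Reasoning
  reassociate : ∀ a b c → bit (a ∧ b) * bit c ≡ bit a * bit (b ∧ c)
  reassociate a b c rewrite bit-∧ a b | bit-∧ b c = *-assoc (bit a) (bit b) (bit c)

Represents-compose : ∀ {S : Fin (length Y) → Fin (length X) → Bool} {T} →
                     (∀ j → Represents s X (S j) (List.lookup Y j)) → Represents s Y T z →
                     Represents s X (compose S T) z
Represents-compose {Y = Y} {X = X} {s = s} {z = z} {S} {T} rS rT = represents composed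
  where
  open ≡-Reasoning
  composed : ∀ i → count X (compose S T) i ≈⟨ s ⟩ bit (lookup z i)
  composed i = begin
    fromℕ s (count X (compose S T) i)
      ≡⟨ cong (fromℕ s) (sum-cong-≗ (λ q → bit-positive-∧ _ (xᵢ q))) ⟩
    fromℕ s (∑[ q < length X ] truncate (f q))
      ≡⟨ ∑-truncate s f (lookup z i) f≈z ⟩
    fromℕ s (sum f)
      ≡⟨ f≈z ⟩
    fromℕ s (bit (lookup z i)) ∎
    where
    xᵢ : Fin (length X) → Bool
    xᵢ q = lookup (List.lookup X q) i
    f : Fin (length X) → ℕ
    f q = (∑[ j < length Y ] bit (T j ∧ S j q)) * bit (xᵢ q)
    f≈z : sum f ≈⟨ s ⟩ bit (lookup z i)
    f≈z = begin
      fromℕ s (sum f)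
        ≡⟨ cong (fromℕ s) (∑-bit-compose S T xᵢ) ⟩
      fromℕ s (∑[ j < length Y ] (bit (T j) * count X (S j) i))
        ≡⟨ ∑-cong-≈ s (λ j → bit-*-cong s (T j) (count≈ (rS j) i)) ⟩
      fromℕ s (∑[ j < length Y ] (bit (T j) * bit (lookup (List.lookup Y j) i)))
        ≡⟨ cong (fromℕ s) (sum-cong-≗ (λ j → sym (bit-∧ (T j) _))) ⟩
      fromℕ s (count Y T i)
        ≡⟨ count≈ rT i ⟩
      fromℕ s (bit (lookup z i)) ∎

SpansVec-trans : Spans s X Y → SpansVec s Y z → SpansVec s X z
SpansVec-trans {X = X} {Y = Y} {z = z} X→Y Y→z =
  Represents⇒SpansVec
    (Represents-compose (λ j → SpansVec⇒Represents {X = X} {y = List.lookup Y j} (X→Y _ (∈-lookup {xs = Y} j)))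
                        (SpansVec⇒Represents {X = Y} {y = z} Y→z))

Spans-trans : Spans s X Y → Spans s Y Z → Spans s X Z
Spans-trans {X = X} {Y = Y} X→Y Y→Z z z∈Z = SpansVec-trans {X = X} {Y = Y} X→Y (Y→Z z z∈Z)

indicator : x ∈ X → Fin (length X) → Bool
indicator (here _)    zero    = true
indicator (here _)    (suc _) = false
indicator (there _)   zero    = false
indicator (there x∈X) (suc j) = indicator x∈X j

count-indicator : (x∈X : x ∈ X) → ∀ i → count X (indicator x∈X) i ≡ bit (lookup x i)
count-indicator {X = _ ∷ X} (here refl) i =
  trans (cong (bit _ +_) (sum-replicate-zero (length X))) (+-identityʳ _)
count-indicator (there x∈X) i = count-indicator x∈X i

∈⇒SpansVec : x ∈ X → SpansVec s X x
∈⇒SpansVec {x = x} {X = X} {s = s} x∈X =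
  Represents⇒SpansVec {X = X} {y = x} (represents (cong (fromℕ s) ∘ count-indicator x∈X))

restrict : (X : VSet n) (p : Fin (length X)) → (Fin (length X) → Bool) → Fin (length (removeAt X p)) → Bool
restrict (_ ∷ X) zero    c         = c ∘ suc
restrict (_ ∷ X) (suc p) c zero    = c zero
restrict (_ ∷ X) (suc p) c (suc j) = restrict X p (c ∘ suc) j

count-restrict : ∀ (X : VSet n) p c → c p ≡ false → ∀ i → count (removeAt X p) (restrict X p c) i ≡ count X c i
count-restrict (_ ∷ X) zero    c cₚ i rewrite cₚ = refl
count-restrict (x ∷ X) (suc p) c cₚ i = cong (bit (c zero ∧ lookup x i) +_) (count-restrict X p (c ∘ suc) cₚ i)

Represents-removeAt : ∀ {c} p → Represents s X c y → c p ≡ false → Represents s (removeAt X p) (restrict X p c) y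
Represents-removeAt {s = s} {X = X} {c = c} p r cₚ =
  represents λ i → trans (cong (fromℕ s) (count-restrict X p c cₚ i)) (count≈ r i)

∈-removeAt : ∀ {A : Set} (xs : List A) p {v} → v ∈ xs → v ≢ List.lookup xs p → v ∈ removeAt xs p
∈-removeAt (_ ∷ _)  zero    (here refl) v≢ = ⊥-elim (v≢ refl)
∈-removeAt (_ ∷ _)  zero    (there v∈)  v≢ = v∈
∈-removeAt (_ ∷ _)  (suc p) (here refl) v≢ = here refl
∈-removeAt (_ ∷ xs) (suc p) (there v∈)  v≢ = there (∈-removeAt xs p v∈ v≢)

All-removeAt : ∀ {A : Set} {P : A → Set} (xs : List A) p → All P xs → All P (removeAt xs p)
All-removeAt (_ ∷ _)  zero    (_ ∷ pxs)  = pxs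
All-removeAt (_ ∷ xs) (suc p) (px ∷ pxs) = px ∷ All-removeAt xs p pxs

Unique-removeAt : ∀ {A : Set} (xs : List A) p → Unique xs → Unique (removeAt xs p)
Unique-removeAt (_ ∷ _)  zero    (_ ∷ u)   = u
Unique-removeAt (_ ∷ xs) (suc p) (x∉ ∷ u) = All-removeAt xs p x∉ ∷ Unique-removeAt xs p u

Irredundant : Setting → VSet n → Set
Irredundant s U = ∀ p → ¬ SpansVec s (removeAt U p) (List.lookup U p)

base-irredundant : ∀ {m} {A : BMatrix n m} → IsBase s A U → Irredundant s U
base-irredundant {s = s} {U = U} (unique , spansA , minimal) p U∖p→Uₚ =
  n≮n _ (subst (_≤ length (removeAt U p)) (length-removeAt′ U p) shorter)
  where
  U∖p→U : Spans s (removeAt U p) U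
  U∖p→U v v∈U with ≡-dec _≟ᴮ_ v (List.lookup U p)
  ... | yes refl = U∖p→Uₚ
  ... | no v≢  = ∈⇒SpansVec (∈-removeAt U p v∈U v≢)
  shorter : length U ≤ length (removeAt U p)
  shorter = minimal _ (Unique-removeAt U p unique)
                    (λ j → SpansVec-trans {X = removeAt U p} {Y = U} U∖p→U (spansA j))

irredundant-⊆ : Irredundant s U → Spans s U V → Spans s V U → ∀ {u} → u ∈ U → u ∈ V
irredundant-⊆ {s = s} {U = U} {V = V} irredundant U→V V→U {u} u∈U = byCoefficient (compose S T p) refl
  where
  p = index u∈U
  u≡Uₚ : u ≡ List.lookup U p
  u≡Uₚ = lookup-index u∈U
  S : Fin (length V) → Fin (length U) → Bool
  S j = proj₁ (U→V _ (∈-lookup {xs = V} j))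
  rS : ∀ j → Represents s U (S j) (List.lookup V j)
  rS j = SpansVec⇒Represents {X = U} {y = List.lookup V j} (U→V _ (∈-lookup {xs = V} j))
  T = proj₁ (V→U u u∈U)
  rT : Represents s V T u
  rT = SpansVec⇒Represents {X = V} {y = u} (V→U u u∈U)
  byCoefficient : ∀ b → compose S T p ≡ b → u ∈ V
  byCoefficient false cₚ = ⊥-elim (irredundant p
    (subst (SpansVec s (removeAt U p)) u≡Uₚ
      (Represents⇒SpansVec (Represents-removeAt p (Represents-compose rS rT) cₚ))))
  byCoefficient true cₚ with compose-witness {S = S} cₚ
  ... | j , Tⱼ , Sⱼₚ = subst (_∈ V) Vⱼ≡u (∈-lookup {xs = V} j)
    where
    Vⱼ≡u : List.lookup V j ≡ u
    Vⱼ≡u = ⊑-antisym (Represents⇒⊑ rT Tⱼ)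
                     (subst (_⊑ List.lookup V j) (sym u≡Uₚ) (Represents⇒⊑ (rS j) Sⱼₚ))

Edge⁺⇒Spans : ∀ {m} {A : BMatrix n m} → TransClosure (Edge s A) U V → Spans s U V
Edge⁺⇒Spans [ (_ , _ , _ , U→V) ] = U→V
Edge⁺⇒Spans {U = U} (_∷_ {y = W} (_ , _ , _ , U→W) W→⁺V) =
  Spans-trans {X = U} {Y = W} U→W (Edge⁺⇒Spans W→⁺V)

mainTheorem13 : (s : Setting) (n m : ℕ) (A : BMatrix n m) → Acyclic s A
mainTheorem13 s n m A U V [ (_ , _ , U≉V , _) ] = U≉V
mainTheorem13 s n m A U V (_∷_ {y = W} (baseU , baseW , U≉W , U→W) W→⁺V) U≈V =
  U≉W λ v → irredundant-⊆ (base-irredundant baseU) U→W W→U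
          , irredundant-⊆ (base-irredundant baseW) W→U U→W
  where
  W→U : Spans s W U
  W→U y y∈U = Edge⁺⇒Spans W→⁺V y (proj₁ (U≈V y) y∈U)
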